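{- Let $D_1,D_2$ be tournament anti-Sidorenko digraphs, and suppose there is an independent set $I\subset V(D_1)$ with $|I|=v(D_2)$ such that all vertices of $I$ have the same in-neighborhood and the same out-neighborhood in $D_1$. Let $D$ be the digraph obtained from $D_1$ by identifying $V(D_2)$ bijectively with $I$ and adding the edges of $D_2$ on $I$ accordingly. Then $D$ is tournament anti-Sidorenko.
   Context: All digraphs are oriented graphs (no loops, no antiparallel edges). A tournament is an orientation of a complete graph without loops. $t_D(T)=h_D(T)/v(T)^{v(D)}$ where $h_D(T)$ is the number of maps $\phi:V(D)\to V(T)$ with $(\phi(x),\phi(y))\in E(T)$ for every $(x,y)\in E(D)$. $D$ is tournament anti-Sidorenko if $t_D(T)\le2^{ -e(D)}$ for every tournament $T$. -}

module Defs where

open import Data.Nat using (ℕ; zero; suc; _+_; _*_; _^_; _≤_)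
open import Data.Bool using (Bool; true; false; _∧_; _∨_; not; if_then_else_)
open import Data.Fin using (Fin; zero; suc; _≟_)
open import Data.List using (List; []; _∷_; map; concatMap; length; filter; allFin)
open import Data.Nat.ListAction using (sum)
open import Data.Bool.ListAction using (all; any)
open import Data.Product using (_×_)
open import Data.Sum using (_⊎_)
open import Relation.Binary.PropositionalEquality using (_≡_; _≢_)
open import Relation.Nullary.Decidable using (⌊_⌋)
open import Function using (Injective)

record Digraph : Set where
  field
    v     : ℕ
    adj   : Fin v → Fin v → Bool
    loopless : ∀ x → adj x x ≡ false
    oriented : ∀ x y → adj x y ≡ true → adj y x ≡ false
open Digraph public

IsTournament : Digraph → Set
IsTournament T = ∀ x y → x ≢ y → (adj T x y ≡ true) ⊎ (adj T y x ≡ true)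

consF : ∀ {m n} → Fin n → (Fin m → Fin n) → Fin (suc m) → Fin n
consF a f zero    = a
consF a f (suc i) = f i

allMaps : ∀ m n → List (Fin m → Fin n)
allMaps zero    n = (λ ()) ∷ []
allMaps (suc m) n = concatMap (λ f → map (λ a → consF a f) (allFin n)) (allMaps m n)

isHom : ∀ {m n} → (Fin m → Fin m → Bool) → (Fin n → Fin n → Bool)
        → (Fin m → Fin n) → Bool
isHom {m} a b φ = all (λ x → all (λ y → not (a x y) ∨ b (φ x) (φ y)) (allFin m)) (allFin m)

homCount : ∀ {m n} → (Fin m → Fin m → Bool) → (Fin n → Fin n → Bool) → ℕ
homCount {m} {n} a b = length (filter (λ φ → isHom a b φ ≡? true) (allMaps m n))
  where
  open import Data.Bool.Properties using () renaming (_≟_ to _≡?_)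

edgeCount : ∀ {m} → (Fin m → Fin m → Bool) → ℕ
edgeCount {m} a = sum (map (λ x → sum (map (λ y → if a x y then 1 else 0) (allFin m))) (allFin m))

-- Tournament anti-Sidorenko for a digraph with vertex set Fin m and adjacency a:
-- t_D(T) ≤ 2^{-e(D)}, i.e. h_D(T) · 2^{e(D)} ≤ v(T)^{v(D)}, for every tournament T.
TAS : ∀ {m} → (Fin m → Fin m → Bool) → Set
TAS {m} a = ∀ (T : Digraph) → IsTournament T →
  homCount a (adj T) * 2 ^ edgeCount a ≤ v T ^ m

TASDigraph : Digraph → Set
TASDigraph D = TAS (adj D)

glueAdj : (D₁ D₂ : Digraph) → (Fin (v D₂) → Fin (v D₁)) → Fin (v D₁) → Fin (v D₁) → Bool
glueAdj D₁ D₂ ι x y =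
  adj D₁ x y ∨ any (λ i → any (λ j → ⌊ ι i ≟ x ⌋ ∧ ⌊ ι j ≟ y ⌋ ∧ adj D₂ i j) (allFin (v D₂))) (allFin (v D₂))

-- Split a map φ : V(D₁) → V(T) into its values g off the twin set I and its values h on I
-- (override ι g h).  Because the twins are independent and share their neighbourhoods, φ is a
-- homomorphism of D₁ exactly when every h i lies in the set C_g of vertices w compatible with g
-- (sending all of I to w gives a homomorphism), so g has |C_g|^{v(D₂)} such extensions.  A
-- homomorphism of D must moreover restrict on I to a homomorphism of D₂ into the subtournament
-- T[C_g], and as D₂ is tournament anti-Sidorenko there are at most |C_g|^{v(D₂)} 2^{-e(D₂)} of
-- those.  Summing over all g (which counts every map v(T)^{v(D₂)} times) gives
-- h_D(T) 2^{e(D₂)} ≤ h_{D₁}(T) ≤ v(T)^{v(D₁)} 2^{-e(D₁)}, and e(D) ≤ e(D₁) + e(D₂).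

module Submission where

open import Defs
open import Data.Nat using (ℕ; zero; suc; _+_; _*_; _^_; _≤_; z≤n; s≤s)
open import Data.Nat.Properties
  using ( +-*-semiring; module ≤-Reasoning; ≤-refl; ≤-reflexive; ≤-trans; ≤-antisym
        ; +-identityʳ; +-mono-≤; +-monoʳ-≤; *-identityˡ; *-identityʳ; *-comm; *-assoc
        ; *-monoˡ-≤; *-monoʳ-≤; *-cancelˡ-≤; m^n≢0; ^-monoʳ-≤; ^-distribˡ-+-* )
open import Algebra.Properties.Semiring.Sum +-*-semiring
  using (sum-syntax; sum-cong-≗; sum-replicate-zero; ∑-distrib-+; ∑-comm; *-distribˡ-sum)
open import Data.Nat.ListAction using () renaming (sum to sumᴸ)
open import Data.Nat.ListAction.Properties using () renaming (sum-++ to sumᴸ-++)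
open import Data.Bool using (Bool; true; false; T; _∧_; _∨_; not; if_then_else_)
open import Data.Bool.Properties using (T-∧; T-∨; T-≡) renaming (_≟_ to _≟ᵇ_)
open import Data.Bool.ListAction using (all; any; and)
open import Data.Fin using (Fin; zero; suc; _≟_)
open import Data.Fin.Properties using (any?; suc-injective; 0≢1+n)
open import Data.List using (List; []; _∷_; _++_; map; concatMap; length; filter; allFin; tabulate)
open import Data.List.Properties using (map-tabulate; map-cong; map-∘; map-++)
import Data.List.Relation.Unary.All.Properties as All
import Data.List.Relation.Unary.Any.Properties as Any
open import Data.Product using (_×_; _,_; ∃; proj₁)
open import Data.Sum using (inj₁; inj₂)
open import Data.Empty using (⊥-elim)
open import Data.Vec.Functional using (updateAt)
open import Data.Vec.Functional.Properties using (updateAt-updates; updateAt-minimal)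
open import Function using (_∘_; id; const; flip; Injective; _⇔_; mk⇔; Equivalence)
open import Relation.Binary.PropositionalEquality
open import Relation.Nullary using (¬_; yes; no)
open import Relation.Nullary.Decidable using (⌊_⌋; ⌊⌋-map′; fromWitness; T?)

open Equivalence using (to; from)

private
  variable
    k m n s : ℕ

Adjacency : ℕ → Set
Adjacency m = Fin m → Fin m → Bool

𝟙 : Bool → ℕ
𝟙 b = if b then 1 else 0

𝟙-mono : ∀ {x y} → (T x → T y) → 𝟙 x ≤ 𝟙 y
𝟙-mono {false}         _   = z≤n
𝟙-mono {true} {true}   _   = ≤-refl
𝟙-mono {true} {false} x⇒y = ⊥-elim (x⇒y _)

𝟙-cong : ∀ {x y} → T x ⇔ T y → 𝟙 x ≡ 𝟙 y
𝟙-cong x⇔y = ≤-antisym (𝟙-mono (to x⇔y)) (𝟙-mono (from x⇔y))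

𝟙-true : ∀ {x} → T x → 𝟙 x ≡ 1
𝟙-true {true} _ = refl

𝟙-false : ∀ {x} → ¬ T x → 𝟙 x ≡ 0
𝟙-false {false} _  = refl
𝟙-false {true}  ¬x = ⊥-elim (¬x _)

𝟙-∧ : ∀ x y → 𝟙 (x ∧ y) ≡ 𝟙 x * 𝟙 y
𝟙-∧ true  y = sym (+-identityʳ (𝟙 y))
𝟙-∧ false y = refl

𝟙-∨-≤ : ∀ x y → 𝟙 (x ∨ y) ≤ 𝟙 x + 𝟙 y
𝟙-∨-≤ true  y = s≤s z≤n
𝟙-∨-≤ false y = ≤-refl

T-not-∨ : ∀ {x y} → T (not x ∨ y) ⇔ (T x → T y)
T-not-∨ {true}  = mk⇔ (λ y _ → y) (λ x⇒y → x⇒y _)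
T-not-∨ {false} = mk⇔ (λ _ ()) (λ _ → _)

every : (Fin n → Bool) → Bool
every p = all p (allFin _)

T-every : ∀ {p : Fin n → Bool} → T (every p) ⇔ (∀ i → T (p i))
T-every {p = p} = mk⇔ (All.tabulate⁻ ∘ All.all⁺ p _) (All.all⁻ p ∘ All.tabulate⁺)

every-cong : ∀ {p q : Fin n → Bool} → (∀ i → p i ≡ q i) → every p ≡ every q
every-cong p≗q = cong and (map-cong p≗q (allFin _))

T-any-allFin : ∀ {p : Fin n → Bool} i → T (p i) → T (any p (allFin n))
T-any-allFin {p = p} i = Any.any⁺ p ∘ Any.tabulate⁺ i

𝟙-any-≤ : ∀ {A : Set} (p : A → Bool) (f : Fin n → A) → 𝟙 (any p (tabulate f)) ≤ ∑[ i < n ] 𝟙 (p (f i))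
𝟙-any-≤ {zero}  p f = z≤n
𝟙-any-≤ {suc n} p f = ≤-trans (𝟙-∨-≤ (p (f zero)) _) (+-monoʳ-≤ (𝟙 (p (f zero))) (𝟙-any-≤ p (f ∘ suc)))

∑-mono-≤ : ∀ {f g : Fin n → ℕ} → (∀ i → f i ≤ g i) → ∑[ i < n ] f i ≤ ∑[ i < n ] g i
∑-mono-≤ {zero}  _   = z≤n
∑-mono-≤ {suc n} f≤g = +-mono-≤ (f≤g zero) (∑-mono-≤ (f≤g ∘ suc))

∑-const : ∀ n c → ∑[ i < n ] c ≡ n * c
∑-const zero    c = refl
∑-const (suc n) c = cong (c +_) (∑-const n c)

∑-δ : ∀ (c : Fin n) (H : Fin n → ℕ) → ∑[ x < n ] (𝟙 ⌊ c ≟ x ⌋ * H x) ≡ H c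
∑-δ {suc n} zero    H =
  trans (cong₂ _+_ (*-identityˡ (H zero)) (sum-replicate-zero n)) (+-identityʳ (H zero))
-- ⌊_⌋ does not compute through the map′ in suc c ≟ suc x, hence ⌊⌋-map′.
∑-δ {suc n} (suc c) H =
  trans (sum-cong-≗ (λ x → cong (λ b → 𝟙 b * H (suc x)) (⌊⌋-map′ _ _ (c ≟ x)))) (∑-δ c (H ∘ suc))

∑-pushforward : ∀ (ι : Fin k → Fin m) (f : Fin k → ℕ) →
  ∑[ x < m ] ∑[ i < k ] (𝟙 ⌊ ι i ≟ x ⌋ * f i) ≡ ∑[ i < k ] f i
∑-pushforward ι f = trans (∑-comm (λ x i → 𝟙 ⌊ ι i ≟ x ⌋ * f i))
                          (sum-cong-≗ (λ i → ∑-δ (ι i) (const (f i))))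

∑∑-pushforward : ∀ (ι : Fin k → Fin m) (w : Fin k → Fin k → ℕ) →
  ∑[ x < m ] ∑[ y < m ] ∑[ i < k ] ∑[ j < k ] (𝟙 ⌊ ι i ≟ x ⌋ * (𝟙 ⌊ ι j ≟ y ⌋ * w i j))
    ≡ ∑[ i < k ] ∑[ j < k ] w i j
∑∑-pushforward {k} {m} ι w = begin
  ∑[ x < m ] ∑[ y < m ] ∑[ i < k ] ∑[ j < k ] (δ i x * (δ j y * w i j))
    ≡⟨ sum-cong-≗ (λ x → ∑-comm (λ y i → ∑[ j < k ] (δ i x * (δ j y * w i j)))) ⟩
  ∑[ x < m ] ∑[ i < k ] ∑[ y < m ] ∑[ j < k ] (δ i x * (δ j y * w i j))
    ≡⟨ sum-cong-≗ (λ x → sum-cong-≗ (λ i → *-distribˡ-∑∑ (δ i x) (λ y j → δ j y * w i j))) ⟨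
  ∑[ x < m ] ∑[ i < k ] (δ i x * ∑[ y < m ] ∑[ j < k ] (δ j y * w i j))
    ≡⟨ ∑-pushforward ι (λ i → ∑[ y < m ] ∑[ j < k ] (δ j y * w i j)) ⟩
  ∑[ i < k ] ∑[ y < m ] ∑[ j < k ] (δ j y * w i j)
    ≡⟨ sum-cong-≗ (λ i → ∑-pushforward ι (w i)) ⟩
  ∑[ i < k ] ∑[ j < k ] w i j ∎
  where
  open ≡-Reasoning
  δ : Fin k → Fin m → ℕ
  δ i x = 𝟙 ⌊ ι i ≟ x ⌋
  *-distribˡ-∑∑ : ∀ c (g : Fin m → Fin k → ℕ) →
    c * ∑[ y < m ] ∑[ j < k ] g y j ≡ ∑[ y < m ] ∑[ j < k ] (c * g y j)
  *-distribˡ-∑∑ c g =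
    trans (*-distribˡ-sum c (λ y → ∑[ j < k ] g y j)) (sum-cong-≗ (λ y → *-distribˡ-sum c (g y)))

sumᴸ-tabulate : ∀ (f : Fin n → ℕ) → sumᴸ (tabulate f) ≡ ∑[ i < n ] f i
sumᴸ-tabulate {zero}  f = refl
sumᴸ-tabulate {suc n} f = cong (f zero +_) (sumᴸ-tabulate (f ∘ suc))

sumᴸ-map-allFin : ∀ (f : Fin n → ℕ) → sumᴸ (map f (allFin n)) ≡ ∑[ i < n ] f i
sumᴸ-map-allFin f = trans (cong sumᴸ (map-tabulate id f)) (sumᴸ-tabulate f)

edgeCount-∑ : ∀ (a : Adjacency m) → edgeCount a ≡ ∑[ x < m ] ∑[ y < m ] 𝟙 (a x y)
edgeCount-∑ {m = m} a = trans (sumᴸ-map-allFin (λ x → sumᴸ (map (λ y → 𝟙 (a x y)) (allFin m))))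
                          (sum-cong-≗ (λ x → sumᴸ-map-allFin (λ y → 𝟙 (a x y))))

IsHom : Adjacency m → Adjacency n → (Fin m → Fin n) → Set
IsHom a b φ = ∀ x y → T (a x y) → T (b (φ x) (φ y))

IsHom-resp : ∀ {a : Adjacency m} {b : Adjacency n} {φ ψ} → φ ≗ ψ → IsHom a b φ → IsHom a b ψ
IsHom-resp {b = b} φ≗ψ hom x y axy = subst₂ (λ u w → T (b u w)) (φ≗ψ x) (φ≗ψ y) (hom x y axy)

T-isHom : ∀ (a : Adjacency m) (b : Adjacency n) {φ} → T (isHom a b φ) ⇔ IsHom a b φ
T-isHom a b = mk⇔ (λ hom x y → to T-not-∨ (to T-every (to T-every hom x) y))
                  (λ hom → from T-every (λ x → from T-every (λ y → from T-not-∨ (hom x y))))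

isHom-cong : ∀ (a : Adjacency m) (b : Adjacency n) {φ ψ} → φ ≗ ψ → isHom a b φ ≡ isHom a b ψ
isHom-cong a b φ≗ψ =
  every-cong (λ x → every-cong (λ y → cong₂ (λ u w → not (a x y) ∨ b u w) (φ≗ψ x) (φ≗ψ y)))

sumMaps : ∀ m n → ((Fin m → Fin n) → ℕ) → ℕ
sumMaps zero    n F = F (λ ())
sumMaps (suc m) n F = sumMaps m n (λ f → ∑[ a < n ] F (consF a f))

Extensional : ((Fin m → Fin n) → ℕ) → Set
Extensional F = ∀ {φ ψ} → φ ≗ ψ → F φ ≡ F ψ

sumMaps-cong : ∀ {F G : (Fin m → Fin n) → ℕ} → (∀ φ → F φ ≡ G φ) → sumMaps m n F ≡ sumMaps m n G
sumMaps-cong {m = zero}  F≡G = F≡G _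
sumMaps-cong {m = suc m} F≡G = sumMaps-cong {m = m} (λ f → sum-cong-≗ (λ a → F≡G (consF a f)))

sumMaps-mono-≤ : ∀ {F G : (Fin m → Fin n) → ℕ} → (∀ φ → F φ ≤ G φ) → sumMaps m n F ≤ sumMaps m n G
sumMaps-mono-≤ {m = zero}  F≤G = F≤G _
sumMaps-mono-≤ {m = suc m} F≤G = sumMaps-mono-≤ {m = m} (λ f → ∑-mono-≤ (λ a → F≤G (consF a f)))

sumMaps-*ˡ : ∀ c (F : (Fin m → Fin n) → ℕ) → c * sumMaps m n F ≡ sumMaps m n (λ φ → c * F φ)
sumMaps-*ˡ {m = zero}  c F = refl
sumMaps-*ˡ {m = suc m} c F =
  trans (sumMaps-*ˡ {m = m} c _) (sumMaps-cong {m = m} (λ f → *-distribˡ-sum c (λ a → F (consF a f))))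

sumMaps-*ʳ : ∀ c (F : (Fin m → Fin n) → ℕ) → sumMaps m n F * c ≡ sumMaps m n (λ φ → F φ * c)
sumMaps-*ʳ {m = m} c F =
  trans (*-comm _ c) (trans (sumMaps-*ˡ c F) (sumMaps-cong {m = m} (λ φ → *-comm c (F φ))))

sumMaps-∑-comm : ∀ {p} (G : Fin p → (Fin m → Fin n) → ℕ) →
  sumMaps m n (λ φ → ∑[ j < p ] G j φ) ≡ ∑[ j < p ] sumMaps m n (G j)
sumMaps-∑-comm {m = zero}  G = refl
sumMaps-∑-comm {m = suc m} {n = n} G =
  trans (sumMaps-cong {m = m} (λ f → ∑-comm (λ a j → G j (consF a f))))
        (sumMaps-∑-comm {m = m} (λ j f → ∑[ a < n ] G j (consF a f)))

sumMaps-1 : ∀ m → sumMaps m n (λ _ → 1) ≡ n ^ m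
sumMaps-1 zero    = refl
sumMaps-1 {n} (suc m) = begin
  sumMaps m n (λ _ → ∑[ a < n ] 1) ≡⟨ sumMaps-cong {m = m} (λ _ → ∑-const n 1) ⟩
  sumMaps m n (λ _ → n * 1)        ≡⟨ sumMaps-*ˡ {m = m} n (λ _ → 1) ⟨
  n * sumMaps m n (λ _ → 1)        ≡⟨ cong (n *_) (sumMaps-1 m) ⟩
  n * n ^ m                        ∎
  where open ≡-Reasoning

sumMaps-empty : Fin m → (F : (Fin m → Fin 0) → ℕ) → sumMaps m 0 F ≡ 0
sumMaps-empty {m = suc m} _ F = sym (sumMaps-*ˡ {m = m} 0 (λ _ → 0))

length-filter-T : ∀ {A : Set} (p : A → Bool) xs →
  length (filter (λ x → p x ≟ᵇ true) xs) ≡ sumᴸ (map (𝟙 ∘ p) xs)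
length-filter-T p []       = refl
length-filter-T p (x ∷ xs) with p x
... | true  = cong suc (length-filter-T p xs)
... | false = length-filter-T p xs

sumᴸ-map-concatMap : ∀ {A B : Set} (F : B → ℕ) (g : A → List B) xs →
  sumᴸ (map F (concatMap g xs)) ≡ sumᴸ (map (λ x → sumᴸ (map F (g x))) xs)
sumᴸ-map-concatMap F g []       = refl
sumᴸ-map-concatMap F g (x ∷ xs) = begin
  sumᴸ (map F (g x ++ concatMap g xs))               ≡⟨ cong sumᴸ (map-++ F (g x) _) ⟩
  sumᴸ (map F (g x) ++ map F (concatMap g xs))       ≡⟨ sumᴸ-++ (map F (g x)) _ ⟩
  sumᴸ (map F (g x)) + sumᴸ (map F (concatMap g xs)) ≡⟨ cong (_ +_) (sumᴸ-map-concatMap F g xs) ⟩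
  sumᴸ (map F (g x)) + sumᴸ (map _ xs)                ∎
  where open ≡-Reasoning

sumᴸ-allMaps : ∀ m n (F : (Fin m → Fin n) → ℕ) → sumᴸ (map F (allMaps m n)) ≡ sumMaps m n F
sumᴸ-allMaps zero    n F = +-identityʳ (F (λ ()))
sumᴸ-allMaps (suc m) n F = begin
  sumᴸ (map F (allMaps (suc m) n))
    ≡⟨ sumᴸ-map-concatMap F (λ f → map (λ a → consF a f) (allFin n)) (allMaps m n) ⟩
  sumᴸ (map (λ f → sumᴸ (map F (map (λ a → consF a f) (allFin n)))) (allMaps m n))
    ≡⟨ cong sumᴸ (map-cong (λ f → trans (cong sumᴸ (sym (map-∘ (allFin n))))
                                        (sumᴸ-map-allFin (λ a → F (consF a f)))) (allMaps m n)) ⟩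
  sumᴸ (map (λ f → ∑[ a < n ] F (consF a f)) (allMaps m n))
    ≡⟨ sumᴸ-allMaps m n _ ⟩
  sumMaps (suc m) n F ∎
  where open ≡-Reasoning

homCount-sumMaps : ∀ (a : Adjacency m) (b : Adjacency n) → homCount a b ≡ sumMaps m n (𝟙 ∘ isHom a b)
homCount-sumMaps {m = m} {n = n} a b =
  trans (length-filter-T (isHom a b) (allMaps m n)) (sumᴸ-allMaps m n _)

updateAt-congˡ : ∀ {g g′ : Fin m → Fin n} → g ≗ g′ → ∀ c (f : Fin n → Fin n) →
  updateAt g c f ≗ updateAt g′ c f
updateAt-congˡ g≗g′ zero    f zero    = cong f (g≗g′ zero)
updateAt-congˡ g≗g′ zero    f (suc x) = g≗g′ (suc x)
updateAt-congˡ g≗g′ (suc c) f zero    = g≗g′ zero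
updateAt-congˡ g≗g′ (suc c) f (suc x) = updateAt-congˡ (g≗g′ ∘ suc) c f x

consF-cong : ∀ (b : Fin n) {f f′ : Fin m → Fin n} → f ≗ f′ → consF b f ≗ consF b f′
consF-cong b f≗f′ zero    = refl
consF-cong b f≗f′ (suc x) = f≗f′ x

updateAt-consF-zero : ∀ (b a : Fin n) (f : Fin m → Fin n) → updateAt (consF b f) zero (const a) ≗ consF a f
updateAt-consF-zero b a f zero    = refl
updateAt-consF-zero b a f (suc x) = refl

updateAt-consF-suc : ∀ (b : Fin n) (f : Fin m → Fin n) c h →
  updateAt (consF b f) (suc c) h ≗ consF b (updateAt f c h)
updateAt-consF-suc b f c h zero    = refl
updateAt-consF-suc b f c h (suc x) = refl

override : (Fin k → Fin m) → (Fin m → Fin n) → (Fin k → Fin n) → Fin m → Fin n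
override {k = zero}  ι g h = g
override {k = suc k} ι g h = override (ι ∘ suc) (updateAt g (ι zero) (const (h zero))) (h ∘ suc)

override-congˡ : ∀ (ι : Fin k → Fin m) {g g′ : Fin m → Fin n} → g ≗ g′ → ∀ h →
  override ι g h ≗ override ι g′ h
override-congˡ {k = zero}  ι g≗g′ h = g≗g′
override-congˡ {k = suc k} ι g≗g′ h = override-congˡ (ι ∘ suc) (updateAt-congˡ g≗g′ (ι zero) _) (h ∘ suc)

override-outside : ∀ (ι : Fin k → Fin m) (g : Fin m → Fin n) h {x} →
  ¬ (∃ λ i → ι i ≡ x) → override ι g h x ≡ g x
override-outside {k = zero}  ι g h x∉ = refl
override-outside {k = suc k} ι g h x∉ =
  trans (override-outside (ι ∘ suc) _ (h ∘ suc) (λ (i , e) → x∉ (suc i , e)))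
        (updateAt-minimal _ (ι zero) g (λ e → x∉ (zero , sym e)))

override-image : ∀ {ι : Fin k → Fin m} → Injective _≡_ _≡_ ι → ∀ (g : Fin m → Fin n) h i →
  override ι g h (ι i) ≡ h i
override-image {k = suc k} {ι = ι} inj g h zero =
  trans (override-outside (ι ∘ suc) _ (h ∘ suc) (λ (j , e) → 0≢1+n (sym (inj e))))
        (updateAt-updates (ι zero) g)
override-image {k = suc k} inj g h (suc i) =
  override-image (suc-injective ∘ inj) _ (h ∘ suc) i

sumMaps-updateAt : ∀ {F : (Fin m → Fin n) → ℕ} → Extensional F → ∀ c →
  sumMaps m n (λ g → ∑[ a < n ] F (updateAt g c (const a))) ≡ n * sumMaps m n F
sumMaps-updateAt {m = suc m} {n = n} {F = F} ext zero = begin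
  sumMaps m n (λ f → ∑[ b < n ] ∑[ a < n ] F (updateAt (consF b f) zero (const a)))
    ≡⟨ sumMaps-cong {m = m} (λ f → sum-cong-≗ (λ b → sum-cong-≗ (λ a → ext (updateAt-consF-zero b a f)))) ⟩
  sumMaps m n (λ f → ∑[ b < n ] ∑[ a < n ] F (consF a f))
    ≡⟨ sumMaps-cong {m = m} (λ f → ∑-const n _) ⟩
  sumMaps m n (λ f → n * ∑[ a < n ] F (consF a f))
    ≡⟨ sumMaps-*ˡ {m = m} n _ ⟨
  n * sumMaps (suc m) n F ∎
  where open ≡-Reasoning
sumMaps-updateAt {m = suc m} {n = n} {F = F} ext (suc c) = begin
  sumMaps m n (λ f → ∑[ b < n ] ∑[ a < n ] F (updateAt (consF b f) (suc c) (const a)))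
    ≡⟨ sumMaps-cong {m = m} (λ f → sum-cong-≗ (λ b → sum-cong-≗ (λ a →
         ext (updateAt-consF-suc b f c (const a))))) ⟩
  sumMaps m n (λ f → ∑[ b < n ] ∑[ a < n ] F (consF b (updateAt f c (const a))))
    ≡⟨ sumMaps-∑-comm {m = m} (λ b f → ∑[ a < n ] F (consF b (updateAt f c (const a)))) ⟩
  ∑[ b < n ] sumMaps m n (λ f → ∑[ a < n ] F (consF b (updateAt f c (const a))))
    ≡⟨ sum-cong-≗ (λ b → sumMaps-updateAt {F = F ∘ consF b} (ext ∘ consF-cong b) c) ⟩
  ∑[ b < n ] (n * sumMaps m n (λ f → F (consF b f)))
    ≡⟨ *-distribˡ-sum n (λ b → sumMaps m n (F ∘ consF b)) ⟨
  n * ∑[ b < n ] sumMaps m n (λ f → F (consF b f))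
    ≡⟨ cong (n *_) (sumMaps-∑-comm {m = m} (λ b f → F (consF b f))) ⟨
  n * sumMaps (suc m) n F ∎
  where open ≡-Reasoning

sumMaps-override : ∀ {F : (Fin m → Fin n) → ℕ} → Extensional F → (ι : Fin k → Fin m) →
  sumMaps m n (λ g → sumMaps k n (F ∘ override ι g)) ≡ n ^ k * sumMaps m n F
sumMaps-override {k = zero}  ext ι = sym (+-identityʳ _)
sumMaps-override {m = m} {n = n} {k = suc k} {F = F} ext ι = begin
  sumMaps m n (λ g → sumMaps k n (λ f → ∑[ a < n ] F (override ι′ (updateAt g (ι zero) (const a)) f)))
    ≡⟨ sumMaps-cong {m = m} (λ g →
         sumMaps-∑-comm {m = k} (λ a → F ∘ override ι′ (updateAt g (ι zero) (const a)))) ⟩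
  sumMaps m n (λ g → ∑[ a < n ] F′ (updateAt g (ι zero) (const a)))
    ≡⟨ sumMaps-updateAt F′-ext (ι zero) ⟩
  n * sumMaps m n F′
    ≡⟨ cong (n *_) (sumMaps-override ext ι′) ⟩
  n * (n ^ k * sumMaps m n F)
    ≡⟨ *-assoc n _ _ ⟨
  n ^ suc k * sumMaps m n F ∎
  where
  open ≡-Reasoning
  ι′ = ι ∘ suc
  F′ : (Fin m → Fin n) → ℕ
  F′ g = sumMaps k n (F ∘ override ι′ g)
  F′-ext : Extensional F′
  F′-ext g≗g′ = sumMaps-cong {m = k} (λ h → ext (override-congˡ ι′ g≗g′ h))

sumMaps-≤-of-overrides : ∀ {F G : (Fin m → Fin n) → ℕ} → Extensional F → Extensional G →
  (ι : Fin k → Fin m) → (∀ g → sumMaps k n (F ∘ override ι g) ≤ sumMaps k n (G ∘ override ι g)) →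
  sumMaps m n F ≤ sumMaps m n G
sumMaps-≤-of-overrides {m = m} {k = zero} _ _ ι F≤G = sumMaps-mono-≤ {m = m} F≤G
sumMaps-≤-of-overrides {n = zero} {k = suc k} {F = F} _ _ ι _ rewrite sumMaps-empty (ι zero) F = z≤n
sumMaps-≤-of-overrides {m = m} {n = suc n} {k = k} {F} {G} F-ext G-ext ι F≤G =
  *-cancelˡ-≤ (suc n ^ k) {{m^n≢0 (suc n) k}} (begin
    suc n ^ k * sumMaps m (suc n) F                                 ≡⟨ sumMaps-override F-ext ι ⟨
    sumMaps m (suc n) (λ g → sumMaps k (suc n) (F ∘ override ι g)) ≤⟨ sumMaps-mono-≤ {m = m} F≤G ⟩
    sumMaps m (suc n) (λ g → sumMaps k (suc n) (G ∘ override ι g)) ≡⟨ sumMaps-override G-ext ι ⟩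
    suc n ^ k * sumMaps m (suc n) G                                 ∎)
  where open ≤-Reasoning

record Enumeration (c : Fin n → Bool) : Set where
  field
    size           : ℕ
    elem           : Fin size → Fin n
    elem-injective : Injective _≡_ _≡_ elem
    elem-satisfies : ∀ j → T (c (elem j))
    ∑-elem         : ∀ (G : Fin n → ℕ) → (∀ w → ¬ T (c w) → G w ≡ 0) →
                     ∑[ w < n ] G w ≡ ∑[ j < size ] G (elem j)

open Enumeration

enumeration-yes : ∀ {c : Fin (suc n) → Bool} → T (c zero) → Enumeration (c ∘ suc) → Enumeration c
enumeration-yes {n} c₀ E = record
  { size           = suc (size E)
  ; elem           = elem′
  ; elem-injective = injective
  ; elem-satisfies = λ { zero → c₀ ; (suc j) → elem-satisfies E j }
  ; ∑-elem         = λ G G-vanish → cong (G zero +_) (∑-elem E (G ∘ suc) (G-vanish ∘ suc))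
  }
  where
  elem′ : Fin (suc (size E)) → Fin (suc n)
  elem′ zero    = zero
  elem′ (suc j) = suc (elem E j)
  injective : Injective _≡_ _≡_ elem′
  injective {zero}  {zero}  _ = refl
  injective {suc i} {suc j} e = cong suc (elem-injective E (suc-injective e))

enumeration-no : ∀ {c : Fin (suc n) → Bool} → ¬ T (c zero) → Enumeration (c ∘ suc) → Enumeration c
enumeration-no {n} ¬c₀ E = record
  { size           = size E
  ; elem           = suc ∘ elem E
  ; elem-injective = elem-injective E ∘ suc-injective
  ; elem-satisfies = elem-satisfies E
  ; ∑-elem         = λ G G-vanish →
      trans (cong (_+ ∑[ w < n ] G (suc w)) (G-vanish zero ¬c₀)) (∑-elem E (G ∘ suc) (G-vanish ∘ suc))
  }

enumerate : ∀ (c : Fin n → Bool) → Enumeration c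
enumerate {zero}  c = record
  { size = 0 ; elem = λ () ; elem-injective = λ {} ; elem-satisfies = λ () ; ∑-elem = λ _ _ → refl }
enumerate {suc n} c with T? (c zero)
... | yes c₀ = enumeration-yes c₀ (enumerate (c ∘ suc))
... | no ¬c₀ = enumeration-no ¬c₀ (enumerate (c ∘ suc))

sumMaps-reindex : ∀ {c : Fin n → Bool} (E : Enumeration c) {F : (Fin k → Fin n) → ℕ} → Extensional F →
  (∀ h i → ¬ T (c (h i)) → F h ≡ 0) → sumMaps k n F ≡ sumMaps k (size E) (F ∘ (elem E ∘_))
sumMaps-reindex {k = zero} E ext _ = ext (λ ())
sumMaps-reindex {n} {k = suc k} {c} E {F} ext F-vanish = begin
  sumMaps k n (λ f → ∑[ a < n ] F (consF a f))
    ≡⟨ sumMaps-cong {m = k} (λ f → ∑-elem E (F ∘ flip consF f) (λ a → F-vanish (consF a f) zero)) ⟩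
  sumMaps k n F′
    ≡⟨ sumMaps-reindex E F′-ext F′-vanish ⟩
  sumMaps k (size E) (λ f → ∑[ j < size E ] F (consF (elem E j) (elem E ∘ f)))
    ≡⟨ sumMaps-cong {m = k} (λ f → sum-cong-≗ (λ j → ext (consF-∘ j f))) ⟩
  sumMaps (suc k) (size E) (F ∘ (elem E ∘_)) ∎
  where
  open ≡-Reasoning
  F′ : (Fin k → Fin n) → ℕ
  F′ f = ∑[ j < size E ] F (consF (elem E j) f)
  F′-ext : Extensional F′
  F′-ext f≗f′ = sum-cong-≗ (λ j → ext (consF-cong (elem E j) f≗f′))
  F′-vanish : ∀ h i → ¬ T (c (h i)) → F′ h ≡ 0
  F′-vanish h i ¬c =
    trans (sum-cong-≗ (λ j → F-vanish (consF (elem E j) h) (suc i) ¬c)) (sum-replicate-zero (size E))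
  consF-∘ : ∀ j f → consF (elem E j) (elem E ∘ f) ≗ elem E ∘ consF j f
  consF-∘ j f zero    = refl
  consF-∘ j f (suc x) = refl

induced : (𝕋 : Digraph) → (Fin s → Fin (v 𝕋)) → Digraph
induced {s} 𝕋 e = record
  { v        = s
  ; adj      = λ u w → adj 𝕋 (e u) (e w)
  ; loopless = loopless 𝕋 ∘ e
  ; oriented = λ x y → oriented 𝕋 (e x) (e y)
  }

induced-isTournament : ∀ {𝕋} {e : Fin s → Fin (v 𝕋)} → IsTournament 𝕋 → Injective _≡_ _≡_ e →
  IsTournament (induced 𝕋 e)
induced-isTournament {e = e} tour inj x y x≢y = tour (e x) (e y) (x≢y ∘ inj)

TAS-induced : ∀ {b : Adjacency k} → TAS b → (𝕋 : Digraph) → IsTournament 𝕋 → (c : Fin (v 𝕋) → Bool) →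
  sumMaps k (v 𝕋) (λ h → 𝟙 (every (c ∘ h) ∧ isHom b (adj 𝕋) h)) * 2 ^ edgeCount b
    ≤ sumMaps k (v 𝕋) (λ h → 𝟙 (every (c ∘ h)))
TAS-induced {k} {b} tas 𝕋 tour c = begin
  sumMaps k (v 𝕋) (λ h → 𝟙 (every (c ∘ h) ∧ isHom b (adj 𝕋) h)) * 2 ^ e
    ≡⟨ cong (_* 2 ^ e) (sumMaps-reindex {k = k} E ext₁ vanish₁) ⟩
  sumMaps k r (λ h → 𝟙 (every (c ∘ elem E ∘ h) ∧ isHom b (adj 𝕋) (elem E ∘ h))) * 2 ^ e
    ≡⟨ cong (_* 2 ^ e) (sumMaps-cong {m = k} (λ h →
         cong (λ z → 𝟙 (z ∧ isHom b (adj 𝕋) (elem E ∘ h))) (to T-≡ (inside h)))) ⟩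
  sumMaps k r (𝟙 ∘ isHom b (adj T′)) * 2 ^ e
    ≡⟨ cong (_* 2 ^ e) (homCount-sumMaps b (adj T′)) ⟨
  homCount b (adj T′) * 2 ^ e
    ≤⟨ tas T′ (induced-isTournament {𝕋 = 𝕋} tour (elem-injective E)) ⟩
  r ^ k
    ≡⟨ sumMaps-1 k ⟨
  sumMaps k r (λ _ → 1)
    ≡⟨ sumMaps-cong {m = k} (𝟙-true ∘ inside) ⟨
  sumMaps k r (λ h → 𝟙 (every (c ∘ elem E ∘ h)))
    ≡⟨ sumMaps-reindex {k = k} E ext₂ vanish₂ ⟨
  sumMaps k (v 𝕋) (λ h → 𝟙 (every (c ∘ h))) ∎
  where
  open ≤-Reasoning
  e = edgeCount b
  E = enumerate c
  r = size E
  T′ = induced 𝕋 (elem E)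
  inside : ∀ (h : Fin k → Fin r) → T (every (c ∘ elem E ∘ h))
  inside h = from T-every (elem-satisfies E ∘ h)
  ext₁ : Extensional (λ h → 𝟙 (every (c ∘ h) ∧ isHom b (adj 𝕋) h))
  ext₁ h≗h′ = cong₂ (λ u w → 𝟙 (u ∧ w)) (every-cong (cong c ∘ h≗h′)) (isHom-cong b (adj 𝕋) h≗h′)
  ext₂ : Extensional (λ h → 𝟙 (every (c ∘ h)))
  ext₂ h≗h′ = cong 𝟙 (every-cong (cong c ∘ h≗h′))
  vanish₁ : ∀ h i → ¬ T (c (h i)) → 𝟙 (every (c ∘ h) ∧ isHom b (adj 𝕋) h) ≡ 0
  vanish₁ h i ¬ci = 𝟙-false (λ ch → ¬ci (to (T-every {p = c ∘ h}) (proj₁ (to T-∧ ch)) i))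
  vanish₂ : ∀ h i → ¬ T (c (h i)) → 𝟙 (every (c ∘ h)) ≡ 0
  vanish₂ h i ¬ci = 𝟙-false (λ ch → ¬ci (to (T-every {p = c ∘ h}) ch i))

record IndependentTwins (a : Adjacency m) (ι : Fin k → Fin m) : Set where
  field
    injective   : Injective _≡_ _≡_ ι
    independent : ∀ i j → a (ι i) (ι j) ≡ false
    same-in     : ∀ i j z → a z (ι i) ≡ a z (ι j)
    same-out    : ∀ i j z → a (ι i) z ≡ a (ι j) z

-- collapse ι i sends every twin to ι i.  It is an endomorphism because twins share their
-- neighbourhoods, and every edge is fixed by some collapse because, the twins being independent,
-- it has at most one endpoint among them.
collapse : (Fin k → Fin m) → Fin k → Fin m → Fin m
collapse ι i = override ι id (const (ι i))

compatible : Adjacency m → Adjacency n → (Fin k → Fin m) → (Fin m → Fin n) → Fin n → Bool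
compatible a t ι g w = isHom a t (override ι g (const w))

module _ {a : Adjacency m} {ι : Fin k → Fin m} (twins : IndependentTwins a ι) where
  open IndependentTwins twins

  collapse-image : ∀ i j → collapse ι i (ι j) ≡ ι i
  collapse-image i = override-image injective id (const (ι i))

  collapse-outside : ∀ i {x} → ¬ (∃ λ j → ι j ≡ x) → collapse ι i x ≡ x
  collapse-outside i = override-outside ι id (const (ι i))

  no-edge-within : ∀ {i j} → ¬ T (a (ι i) (ι j))
  no-edge-within {i} {j} = subst T (independent i j)

  edge-resp : ∀ {x x′ y y′} → x ≡ x′ → y ≡ y′ → T (a x′ y′) → T (a x y)
  edge-resp refl refl axy = axy

  collapse-isHom : ∀ i → IsHom a a (collapse ι i)
  collapse-isHom i x y axy with any? (λ j → ι j ≟ x) | any? (λ j → ι j ≟ y)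
  ... | yes (j , refl) | yes (j′ , refl) = ⊥-elim (no-edge-within axy)
  ... | yes (j , refl) | no y∉ = edge-resp (collapse-image i j) (collapse-outside i y∉) (subst T (same-out j i y) axy)
  ... | no x∉ | yes (j , refl) = edge-resp (collapse-outside i x∉) (collapse-image i j) (subst T (same-in j i x) axy)
  ... | no x∉ | no y∉          = edge-resp (collapse-outside i x∉) (collapse-outside i y∉) axy

  edge-fixed-by-collapse : Fin k → ∀ {x y} → T (a x y) → ∃ λ i → collapse ι i x ≡ x × collapse ι i y ≡ y
  edge-fixed-by-collapse i₀ {x} {y} axy with any? (λ j → ι j ≟ x) | any? (λ j → ι j ≟ y)
  ... | yes (j , refl) | yes (j′ , refl) = ⊥-elim (no-edge-within axy)
  ... | yes (j , refl) | no y∉ = j , collapse-image j j , collapse-outside j y∉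
  ... | no x∉ | yes (j , refl) = j , collapse-outside j x∉ , collapse-image j j
  ... | no x∉ | no y∉ = i₀ , collapse-outside i₀ x∉ , collapse-outside i₀ y∉

  override-const≗override∘collapse : ∀ (g : Fin m → Fin n) h i →
    override ι g (const (h i)) ≗ override ι g h ∘ collapse ι i
  override-const≗override∘collapse g h i x with any? (λ j → ι j ≟ x)
  ... | yes (j , refl) = trans (override-image injective g (const (h i)) j)
    (sym (trans (cong (override ι g h) (collapse-image i j)) (override-image injective g h i)))
  ... | no x∉ = trans (override-outside ι g (const (h i)) x∉)
    (sym (trans (cong (override ι g h) (collapse-outside i x∉)) (override-outside ι g h x∉)))

  isHom-override⇔ : Fin k → ∀ {t : Adjacency n} g h →
    IsHom a t (override ι g h) ⇔ (∀ i → IsHom a t (override ι g (const (h i))))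
  isHom-override⇔ i₀ {t} g h = mk⇔
    (λ hom i → IsHom-resp {b = t} (sym ∘ override-const≗override∘collapse g h i)
                          (λ x y axy → hom _ _ (collapse-isHom i x y axy)))
    (λ homs x y axy → let (i , fx , fy) = edge-fixed-by-collapse i₀ axy in
       subst₂ (λ u w → T (t (override ι g h u) (override ι g h w))) fx fy
              (IsHom-resp {b = t} (override-const≗override∘collapse g h i) (homs i) x y axy))

  T-isHom-override : Fin k → ∀ {t : Adjacency n} g h →
    T (isHom a t (override ι g h)) ⇔ T (every (compatible a t ι g ∘ h))
  T-isHom-override i₀ {t} g h = mk⇔
    (λ hom → from T-every (λ i → from (T-isHom a t) (to hom⇔ (to (T-isHom a t) hom) i)))
    (λ ev → from (T-isHom a t) (from hom⇔ (λ i → to (T-isHom a t) (to T-every ev i))))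
    where hom⇔ = isHom-override⇔ i₀ {t} g h

fiber-≤ : ∀ {a A : Adjacency m} {b : Adjacency k} {ι : Fin k → Fin m} → IndependentTwins a ι → TAS b →
  (𝕋 : Digraph) → IsTournament 𝕋 →
  (∀ {φ} → IsHom A (adj 𝕋) φ → IsHom a (adj 𝕋) φ × IsHom b (adj 𝕋) (φ ∘ ι)) → ∀ g →
  sumMaps k (v 𝕋) (λ h → 𝟙 (isHom A (adj 𝕋) (override ι g h)) * 2 ^ edgeCount b)
    ≤ sumMaps k (v 𝕋) (λ h → 𝟙 (isHom a (adj 𝕋) (override ι g h)))
fiber-≤ {k = zero} {a} {A} twins tas 𝕋 tour restrict g =
  ≤-trans (≤-reflexive (*-identityʳ _))
          (𝟙-mono (from (T-isHom a (adj 𝕋)) ∘ proj₁ ∘ restrict ∘ to (T-isHom A (adj 𝕋))))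
fiber-≤ {k = suc k} {a} {A} {b} {ι} twins tas 𝕋 tour restrict g = begin
  sumMaps (suc k) (v 𝕋) (λ h → 𝟙 (isHom A t (override ι g h)) * 2 ^ e)
    ≡⟨ sumMaps-*ʳ {m = suc k} (2 ^ e) (𝟙 ∘ isHom A t ∘ override ι g) ⟨
  sumMaps (suc k) (v 𝕋) (𝟙 ∘ isHom A t ∘ override ι g) * 2 ^ e
    ≤⟨ *-monoˡ-≤ (2 ^ e) (sumMaps-mono-≤ {m = suc k} (𝟙-mono ∘ compatible-hom)) ⟩
  sumMaps (suc k) (v 𝕋) (λ h → 𝟙 (every (compatible a t ι g ∘ h) ∧ isHom b t h)) * 2 ^ e
    ≤⟨ TAS-induced {k = suc k} {b = b} tas 𝕋 tour (compatible a t ι g) ⟩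
  sumMaps (suc k) (v 𝕋) (λ h → 𝟙 (every (compatible a t ι g ∘ h)))
    ≡⟨ sumMaps-cong {m = suc k} (λ h → 𝟙-cong (T-isHom-override twins zero {t} g h)) ⟨
  sumMaps (suc k) (v 𝕋) (𝟙 ∘ isHom a t ∘ override ι g) ∎
  where
  open ≤-Reasoning
  open IndependentTwins twins using (injective)
  t = adj 𝕋
  e = edgeCount b
  compatible-hom : ∀ h → T (isHom A t (override ι g h)) → T (every (compatible a t ι g ∘ h) ∧ isHom b t h)
  compatible-hom h hom =
    let (homa , homb) = restrict (to (T-isHom A t) hom) in
    from T-∧ ( to (T-isHom-override twins zero {t} g h) (from (T-isHom a t) homa)
             , from (T-isHom b t) (IsHom-resp {b = t} (override-image injective g h) homb))

glue-restrict : ∀ (D₁ D₂ : Digraph) (ι : Fin (v D₂) → Fin (v D₁)) {t : Adjacency n} {φ} →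
  IsHom (glueAdj D₁ D₂ ι) t φ → IsHom (adj D₁) t φ × IsHom (adj D₂) t (φ ∘ ι)
glue-restrict D₁ D₂ ι hom =
  (λ x y axy → hom x y (from T-∨ (inj₁ axy))) ,
  (λ i j bij → hom (ι i) (ι j) (from T-∨ (inj₂ (T-any-allFin i (T-any-allFin j
     (from T-∧ (fromWitness {a? = ι i ≟ ι i} refl ,
                from T-∧ (fromWitness {a? = ι j ≟ ι j} refl , bij))))))))

homCount-glue-≤ : ∀ (D₁ D₂ : Digraph) (ι : Fin (v D₂) → Fin (v D₁)) → IndependentTwins (adj D₁) ι →
  TASDigraph D₂ → (𝕋 : Digraph) → IsTournament 𝕋 →
  homCount (glueAdj D₁ D₂ ι) (adj 𝕋) * 2 ^ edgeCount (adj D₂) ≤ homCount (adj D₁) (adj 𝕋)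
homCount-glue-≤ D₁ D₂ ι twins tas₂ 𝕋 tour = begin
  homCount A t * 2 ^ e
    ≡⟨ cong (_* 2 ^ e) (homCount-sumMaps A t) ⟩
  sumMaps (v D₁) (v 𝕋) (𝟙 ∘ isHom A t) * 2 ^ e
    ≡⟨ sumMaps-*ʳ {m = v D₁} (2 ^ e) (𝟙 ∘ isHom A t) ⟩
  sumMaps (v D₁) (v 𝕋) (λ φ → 𝟙 (isHom A t φ) * 2 ^ e)
    ≤⟨ sumMaps-≤-of-overrides (cong (λ z → 𝟙 z * 2 ^ e) ∘ isHom-cong A t) (cong 𝟙 ∘ isHom-cong a t) ι
         (fiber-≤ twins tas₂ 𝕋 tour (glue-restrict D₁ D₂ ι {t = t})) ⟩
  sumMaps (v D₁) (v 𝕋) (𝟙 ∘ isHom a t)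
    ≡⟨ homCount-sumMaps a t ⟨
  homCount a t ∎
  where
  open ≤-Reasoning
  A = glueAdj D₁ D₂ ι
  a = adj D₁
  t = adj 𝕋
  e = edgeCount (adj D₂)

𝟙-glue-≤ : ∀ (D₁ D₂ : Digraph) (ι : Fin (v D₂) → Fin (v D₁)) x y →
  𝟙 (glueAdj D₁ D₂ ι x y)
    ≤ 𝟙 (adj D₁ x y) + ∑[ i < v D₂ ] ∑[ j < v D₂ ] (𝟙 ⌊ ι i ≟ x ⌋ * (𝟙 ⌊ ι j ≟ y ⌋ * 𝟙 (adj D₂ i j)))
𝟙-glue-≤ D₁ D₂ ι x y = begin
  𝟙 (adj D₁ x y ∨ any (λ i → any (edge i) (allFin k₂)) (allFin k₂))
    ≤⟨ 𝟙-∨-≤ (adj D₁ x y) _ ⟩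
  𝟙 (adj D₁ x y) + 𝟙 (any (λ i → any (edge i) (allFin k₂)) (allFin k₂))
    ≤⟨ +-monoʳ-≤ (𝟙 (adj D₁ x y)) (𝟙-any-≤ (λ i → any (edge i) (allFin k₂)) id) ⟩
  𝟙 (adj D₁ x y) + ∑[ i < k₂ ] 𝟙 (any (edge i) (allFin k₂))
    ≤⟨ +-monoʳ-≤ (𝟙 (adj D₁ x y)) (∑-mono-≤ (λ i → 𝟙-any-≤ (edge i) id)) ⟩
  𝟙 (adj D₁ x y) + ∑[ i < k₂ ] ∑[ j < k₂ ] 𝟙 (edge i j)
    ≡⟨ cong (𝟙 (adj D₁ x y) +_) (sum-cong-≗ (λ i → sum-cong-≗ (λ j → 𝟙-edge i j))) ⟩
  𝟙 (adj D₁ x y) + ∑[ i < k₂ ] ∑[ j < k₂ ] (𝟙 ⌊ ι i ≟ x ⌋ * (𝟙 ⌊ ι j ≟ y ⌋ * 𝟙 (adj D₂ i j))) ∎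
  where
  open ≤-Reasoning
  k₂ = v D₂
  edge : Fin k₂ → Fin k₂ → Bool
  edge i j = ⌊ ι i ≟ x ⌋ ∧ ⌊ ι j ≟ y ⌋ ∧ adj D₂ i j
  𝟙-edge : ∀ i j → 𝟙 (edge i j) ≡ 𝟙 ⌊ ι i ≟ x ⌋ * (𝟙 ⌊ ι j ≟ y ⌋ * 𝟙 (adj D₂ i j))
  𝟙-edge i j = trans (𝟙-∧ ⌊ ι i ≟ x ⌋ _) (cong (𝟙 ⌊ ι i ≟ x ⌋ *_) (𝟙-∧ ⌊ ι j ≟ y ⌋ (adj D₂ i j)))

edgeCount-glue-≤ : ∀ (D₁ D₂ : Digraph) (ι : Fin (v D₂) → Fin (v D₁)) →
  edgeCount (glueAdj D₁ D₂ ι) ≤ edgeCount (adj D₁) + edgeCount (adj D₂)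
edgeCount-glue-≤ D₁ D₂ ι = begin
  edgeCount (glueAdj D₁ D₂ ι)
    ≡⟨ edgeCount-∑ (glueAdj D₁ D₂ ι) ⟩
  ∑[ x < m₁ ] ∑[ y < m₁ ] 𝟙 (glueAdj D₁ D₂ ι x y)
    ≤⟨ ∑-mono-≤ (λ x → ∑-mono-≤ (λ y → 𝟙-glue-≤ D₁ D₂ ι x y)) ⟩
  ∑[ x < m₁ ] ∑[ y < m₁ ] (𝟙 (adj D₁ x y) + glued x y)
    ≡⟨ sum-cong-≗ (λ x → ∑-distrib-+ (λ y → 𝟙 (adj D₁ x y)) (glued x)) ⟩
  ∑[ x < m₁ ] (∑[ y < m₁ ] 𝟙 (adj D₁ x y) + ∑[ y < m₁ ] glued x y)
    ≡⟨ ∑-distrib-+ (λ x → ∑[ y < m₁ ] 𝟙 (adj D₁ x y)) (λ x → ∑[ y < m₁ ] glued x y) ⟩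
  ∑[ x < m₁ ] ∑[ y < m₁ ] 𝟙 (adj D₁ x y) + ∑[ x < m₁ ] ∑[ y < m₁ ] glued x y
    ≡⟨ cong₂ _+_ (sym (edgeCount-∑ (adj D₁)))
                 (trans (∑∑-pushforward ι (λ i j → 𝟙 (adj D₂ i j))) (sym (edgeCount-∑ (adj D₂)))) ⟩
  edgeCount (adj D₁) + edgeCount (adj D₂) ∎
  where
  open ≤-Reasoning
  m₁ = v D₁
  glued : Fin m₁ → Fin m₁ → ℕ
  glued x y = ∑[ i < v D₂ ] ∑[ j < v D₂ ] (𝟙 ⌊ ι i ≟ x ⌋ * (𝟙 ⌊ ι j ≟ y ⌋ * 𝟙 (adj D₂ i j)))

proposition3p6 : (D₁ D₂ : Digraph) → TASDigraph D₁ → TASDigraph D₂ →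
    (ι : Fin (v D₂) → Fin (v D₁)) → Injective _≡_ _≡_ ι →
    (∀ i j → adj D₁ (ι i) (ι j) ≡ false) →
    (∀ i j z → adj D₁ z (ι i) ≡ adj D₁ z (ι j)) →
    (∀ i j z → adj D₁ (ι i) z ≡ adj D₁ (ι j) z) →
    TAS (glueAdj D₁ D₂ ι)
proposition3p6 D₁ D₂ tas₁ tas₂ ι inj indep same-in same-out 𝕋 tour = begin
  hom * 2 ^ edgeCount (glueAdj D₁ D₂ ι)
    ≤⟨ *-monoʳ-≤ hom (^-monoʳ-≤ 2 (edgeCount-glue-≤ D₁ D₂ ι)) ⟩
  hom * 2 ^ (e₁ + e₂)
    ≡⟨ cong (hom *_) (trans (^-distribˡ-+-* 2 e₁ e₂) (*-comm (2 ^ e₁) (2 ^ e₂))) ⟩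
  hom * (2 ^ e₂ * 2 ^ e₁)
    ≡⟨ *-assoc hom (2 ^ e₂) (2 ^ e₁) ⟨
  hom * 2 ^ e₂ * 2 ^ e₁
    ≤⟨ *-monoˡ-≤ (2 ^ e₁) (homCount-glue-≤ D₁ D₂ ι twins tas₂ 𝕋 tour) ⟩
  homCount (adj D₁) (adj 𝕋) * 2 ^ e₁
    ≤⟨ tas₁ 𝕋 tour ⟩
  v 𝕋 ^ v D₁ ∎
  where
  open ≤-Reasoning
  hom = homCount (glueAdj D₁ D₂ ι) (adj 𝕋)
  e₁ = edgeCount (adj D₁)
  e₂ = edgeCount (adj D₂)
  twins : IndependentTwins (adj D₁) ι
  twins = record { injective = inj ; independent = indep ; same-in = same-in ; same-out = same-out }
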